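{- Let $p_1<p_2<\dots<p_d$ be distinct primes, $M=p_1^2\cdots p_d^2$, $M_j=M/p_j^2$, and $$B=\Big\{\sum_{j=1}^d c_jM_j:\ c_j\in\{0,1,\dots,p_j-1\}\Big\}\subset\mathbb{Z}_M.$$ Let $A\subset\mathbb{Z}_M$ with $A\oplus B=\mathbb{Z}_M$. If $p_j>p_2p_3\cdots p_{j-1}$ for each $j\in\{3,\dots,d\}$, then there exists $j\in\{1,\dots,d\}$ such that $M/p_j\in\mathrm{Div}(A)$.
   Context: $A\oplus B=\mathbb{Z}_M$ (a tiling) means every element of $\mathbb{Z}_M$ can be written uniquely as $a+b\bmod M$ with $a\in A$, $b\in B$. For integers $m,n$, $(m,n)$ is their gcd, and $\mathrm{Div}(A)=\{(a-a',M): a,a'\in A\}$ (elements of $\mathbb{Z}_M$ represented by integers). -}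

module Defs where

open import Data.Nat using (ℕ; zero; suc; _+_; _*_; _∸_; _^_; _≤_; _<_; ∣_-_∣)
open import Data.Nat.Properties using (_≟_)
open import Data.Nat.GCD using (gcd)
open import Data.Nat.Primality using (Prime)
open import Data.List using (List; applyUpTo; filter; map)
open import Data.Nat.ListAction using (sum; product)
open import Data.Integer as ℤ using (ℤ; +_)
open import Data.Integer.Divisibility as ℤD using ()
open import Data.Product using (Σ; ∃; _×_)
open import Relation.Binary.PropositionalEquality using (_≡_)
open import Relation.Nullary using (¬_; ¬?)

range : ℕ → ℕ → List ℕ
range lo hi = applyUpTo (λ k → lo + k) (suc hi ∸ lo)

∏[_⋯_] : ℕ → ℕ → (ℕ → ℕ) → ℕ
∏[ lo ⋯ hi ] f = product (map f (range lo hi))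

∑[_⋯_] : ℕ → ℕ → (ℕ → ℕ) → ℕ
∑[ lo ⋯ hi ] f = sum (map f (range lo hi))

-- Primes are indexed 1..d by p : ℕ → ℕ (values outside 1..d are irrelevant).

Mod : ℕ → (ℕ → ℕ) → ℕ
Mod d p = ∏[ 1 ⋯ d ] (λ i → p i ^ 2)

-- M_j = M / p_j^2 = ∏_{i ∈ {1..d}, i ≠ j} p_i^2
Mj : ℕ → (ℕ → ℕ) → ℕ → ℕ
Mj d p j = product (map (λ i → p i ^ 2) (filter (λ i → ¬? (i ≟ j)) (range 1 d)))

_≡_[mod_] : ℕ → ℕ → ℕ → Set
x ≡ y [mod m ] = (+ m) ℤD.∣ ((+ x) ℤ.- (+ y))

-- Elements of ℤ_M are represented by naturals x < M.
-- B = { Σ_j c_j M_j : c_j ∈ {0,…,p_j - 1} } ⊂ ℤ_M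
InB : ℕ → (ℕ → ℕ) → ℕ → Set
InB d p b = b < Mod d p × ∃ λ (c : ℕ → ℕ) →
  (∀ j → 1 ≤ j → j ≤ d → c j < p j) ×
  b ≡ ∑[ 1 ⋯ d ] (λ j → c j * Mj d p j) [mod Mod d p ]

Tiles : ℕ → (ℕ → Set) → (ℕ → Set) → Set
Tiles M A B =
  (∀ a → A a → a < M) × (∀ b → B b → b < M) ×
  (∀ x → x < M →
     (∃ λ a → ∃ λ b → A a × B b × (a + b) ≡ x [mod M ]) ×
     (∀ a b a' b' → A a → B b → A a' → B b' →
        (a + b) ≡ x [mod M ] → (a' + b') ≡ x [mod M ] → a ≡ a' × b ≡ b'))

-- m ∈ Div(A) = { (a - a', M) : a, a' ∈ A }.  For a, a' ∈ [0, M),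
-- gcd((a - a') mod M, M) = gcd(|a - a'|, M).
InDiv : ℕ → (ℕ → Set) → ℕ → Set
InDiv M A m = ∃ λ a → ∃ λ a' → A a × A a' × gcd ∣ a - a' ∣ M ≡ m

{-# OPTIONS --safe #-}
module Submission where

-- Write x ∈ ℤ_M uniquely as x = a + Σ c_j M_j with a ∈ A and digits 0 ≤ c_j < p_j.
-- If digit m of y is 0, so is digit m of y + M/p_m: otherwise y + (p_m - 1) M_m
-- would have two representations.  Suppose no M/p_j lies in Div(A) and fix a₀ ∈ A.
-- By descending induction on k, every a₀ + Σ_{j ≤ k} n_j M_j has all digits above
-- k equal to 0.  Were digit k+1 of y + M_j nonzero for such a y with j ≤ k, then
-- along y + u M/p_{k+1} digit j would stay p_j - 1 and the digits ≥ k+1 fixed, so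
-- the points with u < p_{k+1} would take at most ∏_{i ≤ k, i ≠ j} p_i < p_{k+1}
-- values of their B-component.  Two sharing one have A-components differing by
-- δ M/p_{k+1} with 0 < δ < p_{k+1}, whence M/p_{k+1} ∈ Div(A).  At k = 1 the same
-- pigeonhole with all digits fixed gives M/p_1 ∈ Div(A).  Membership in Div(A) is
-- decidable, so the contradiction yields the statement.

open import Defs
open import Data.Empty using (⊥)
open import Data.Fin using (Fin; toℕ)
open import Data.Fin.Properties using (pigeonhole; toℕ<n)
import Data.Integer as ℤ
open import Data.Integer.Properties using (m-n≡m⊖n; ∣⊖∣-≤; ∣m⊖n∣≡∣n⊖m∣)
open import Data.List using (List; []; _∷_; [_]; map; filter; foldr; length; upTo; concatMap; lookup)
open import Data.List.Properties using (∷-injective; filter-all; filter-reject; filter-accept; length-++; length-map; length-upTo; map-cong-local)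
open import Data.List.Membership.Propositional using (_∈_; _∉_)
open import Data.List.Membership.Propositional.Properties using (∈-map⁺; ∈-upTo⁺; ∈-applyUpTo⁺; ∈-applyUpTo⁻; ∈-concatMap⁺; ∈-filter⁺; ∈-filter⁻)
open import Data.List.Relation.Unary.All as All using (All; []; _∷_)
import Data.List.Relation.Unary.All.Properties as AllP
open import Data.List.Relation.Unary.Any as Any using (here; there)
open import Data.List.Relation.Unary.Any.Properties using (lookup-index)
open import Data.List.Relation.Unary.Unique.Propositional using (Unique; _∷_)
import Data.List.Relation.Unary.Unique.Propositional.Properties as Unique
open import Data.Nat
open import Data.Nat.DivMod
open import Data.Nat.Divisibility
open import Data.Nat.GCD using (gcd; gcd-greatest; gcd[m,n]∣m; gcd[m,n]∣n)
open import Data.Nat.ListAction using (sum; product)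
open import Data.Nat.ListAction.Properties using (product≢0; ∈⇒∣product)
open import Data.Nat.Primality using (Prime; euclidsLemma; prime⇒nonZero; prime⇒nonTrivial; prime⇒irreducible)
open import Data.Nat.Properties
open import Data.Nat.Tactic.RingSolver using (solve-∀)
open import Data.Product using (∃; ∃₂; _×_; _,_; proj₁; proj₂)
open import Data.Sum using (inj₁; inj₂)
open import Function using (_∘_; it)
open import Relation.Binary.Definitions using (tri<; tri≈; tri>)
open import Relation.Binary.PropositionalEquality hiding ([_])
open import Algebra.Definitions {A = ℕ} _≡_ using (Associative; Commutative)
open import Relation.Nullary using (¬_; ¬?; Dec; yes; no; map′; _×-dec_; contradiction)
open import Relation.Nullary.Decidable using (decidable-stable)
open import Data.List.Membership.DecPropositional _≟_ using (_∈?_)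

∣+m-+n∣≡∣m-n∣ : ∀ m n → ℤ.∣ ℤ.+ m ℤ.- ℤ.+ n ∣ ≡ ∣ m - n ∣
∣+m-+n∣≡∣m-n∣ m n = trans (cong ℤ.∣_∣ (m-n≡m⊖n m n)) ∣m⊖n∣≡∣m-n∣
  where
  open ≡-Reasoning
  ∣m⊖n∣≡∣m-n∣ : ℤ.∣ m ℤ.⊖ n ∣ ≡ ∣ m - n ∣
  ∣m⊖n∣≡∣m-n∣ with ≤-total m n
  ... | inj₁ m≤n = trans (∣⊖∣-≤ m≤n) (sym (m≤n⇒∣m-n∣≡n∸m m≤n))
  ... | inj₂ n≤m = begin
    ℤ.∣ m ℤ.⊖ n ∣ ≡⟨ ∣m⊖n∣≡∣n⊖m∣ m n ⟩
    ℤ.∣ n ℤ.⊖ m ∣ ≡⟨ ∣⊖∣-≤ n≤m ⟩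
    m ∸ n         ≡⟨ m≤n⇒∣n-m∣≡n∸m n≤m ⟨
    ∣ m - n ∣     ∎

module _ {n : ℕ} .{{_ : NonZero n}} where
  open ≡-Reasoning

  %≡⇒∣∣-∣ : ∀ {x y} → x % n ≡ y % n → n ∣ ∣ x - y ∣
  %≡⇒∣∣-∣ {x} {y} eq = divides ∣ x / n - y / n ∣ (begin
    ∣ x - y ∣                                 ≡⟨ cong₂ ∣_-_∣ (m≡m%n+[m/n]*n x n) (m≡m%n+[m/n]*n y n) ⟩
    ∣ x % n + x / n * n - y % n + y / n * n ∣ ≡⟨ cong (λ r → ∣ x % n + x / n * n - r + y / n * n ∣) eq ⟨
    ∣ x % n + x / n * n - x % n + y / n * n ∣ ≡⟨ ∣m+n-m+o∣≡∣n-o∣ (x % n) _ _ ⟩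
    ∣ x / n * n - y / n * n ∣                 ≡⟨ *-distribʳ-∣-∣ n (x / n) (y / n) ⟨
    ∣ x / n - y / n ∣ * n                     ∎)

  private
    ≤∧∣∣-∣⇒%≡ : ∀ {x y} → y ≤ x → n ∣ ∣ x - y ∣ → x % n ≡ y % n
    ≤∧∣∣-∣⇒%≡ {x} {y} y≤x (divides k eq) = begin
      x % n             ≡⟨ cong (_% n) (m+[n∸m]≡n y≤x) ⟨
      (y + (x ∸ y)) % n ≡⟨ cong (λ t → (y + t) % n) (trans (sym (m≤n⇒∣n-m∣≡n∸m y≤x)) eq) ⟩
      (y + k * n) % n   ≡⟨ [m+kn]%n≡m%n y k n ⟩
      y % n             ∎

  ∣∣-∣⇒%≡ : ∀ {x y} → n ∣ ∣ x - y ∣ → x % n ≡ y % n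
  ∣∣-∣⇒%≡ {x} {y} n∣x-y with ≤-total y x
  ... | inj₁ y≤x = ≤∧∣∣-∣⇒%≡ y≤x n∣x-y
  ... | inj₂ x≤y = sym (≤∧∣∣-∣⇒%≡ x≤y (subst (n ∣_) (∣-∣-comm x y) n∣x-y))

  %≡-congˡ-+ : ∀ k {x y} → x % n ≡ y % n → (k + x) % n ≡ (k + y) % n
  %≡-congˡ-+ k {x} {y} eq = begin
    (k + x) % n         ≡⟨ %-distribˡ-+ k x n ⟩
    (k % n + x % n) % n ≡⟨ cong (λ r → (k % n + r) % n) eq ⟩
    (k % n + y % n) % n ≡⟨ %-distribˡ-+ k y n ⟨
    (k + y) % n         ∎

  %≡-congʳ-+ : ∀ k {x y} → x % n ≡ y % n → (x + k) % n ≡ (y + k) % n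
  %≡-congʳ-+ k {x} {y} eq = begin
    (x + k) % n ≡⟨ cong (_% n) (+-comm x k) ⟩
    (k + x) % n ≡⟨ %≡-congˡ-+ k eq ⟩
    (k + y) % n ≡⟨ cong (_% n) (+-comm k y) ⟩
    (y + k) % n ∎

  %≡-cancelˡ-+ : ∀ k {x y} → (k + x) % n ≡ (k + y) % n → x % n ≡ y % n
  %≡-cancelˡ-+ k {x} {y} eq = ∣∣-∣⇒%≡ (subst (n ∣_) (∣m+n-m+o∣≡∣n-o∣ k x y) (%≡⇒∣∣-∣ eq))

  [mod]⇒%≡ : ∀ {x y} → x ≡ y [mod n ] → x % n ≡ y % n
  [mod]⇒%≡ {x} {y} n∣x-y = ∣∣-∣⇒%≡ (subst (n ∣_) (∣+m-+n∣≡∣m-n∣ x y) n∣x-y)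

  %≡⇒[mod] : ∀ {x y} → x % n ≡ y % n → x ≡ y [mod n ]
  %≡⇒[mod] {x} {y} eq = subst (n ∣_) (sym (∣+m-+n∣≡∣m-n∣ x y)) (%≡⇒∣∣-∣ eq)

∣-sum : ∀ {q xs} → All (q ∣_) xs → q ∣ sum xs
∣-sum {q} []       = q ∣0
∣-sum (q∣x ∷ q∣xs) = ∣m∣n⇒∣m+n q∣x (∣-sum q∣xs)

prime∤product : ∀ {q} → Prime q → ∀ {xs} → All (q ∤_) xs → q ∤ product xs
prime∤product q-prime []               q∣1 = nonTrivial⇒≢1 {{prime⇒nonTrivial q-prime}} (∣1⇒≡1 q∣1)
prime∤product q-prime {x ∷ xs} (q∤x ∷ q∤xs) q∣x*xs with euclidsLemma x (product xs) q-prime q∣x*xs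
... | inj₁ q∣x  = q∤x q∣x
... | inj₂ q∣xs = prime∤product q-prime q∤xs q∣xs

prime-*-cancelʳ-%≡ : ∀ {q G x y} .{{_ : NonZero q}} → Prime q → q ∤ G → (x * G) % q ≡ (y * G) % q →
  x % q ≡ y % q
prime-*-cancelʳ-%≡ {q} {G} {x} {y} q-prime q∤G eq
  with euclidsLemma ∣ x - y ∣ G q-prime (subst (q ∣_) (sym (*-distribʳ-∣-∣ G x y)) (%≡⇒∣∣-∣ eq))
... | inj₁ q∣x-y = ∣∣-∣⇒%≡ q∣x-y
... | inj₂ q∣G   = contradiction q∣G q∤G

gcd-of-shift : ∀ {N q K δ a a'} .{{_ : NonZero N}} → Prime q → N ≡ q * K → 0 < δ → δ < q →
  (a + δ * K) % N ≡ a' % N → gcd ∣ a - a' ∣ N ≡ K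
gcd-of-shift {N} {q} {K} {δ} {a} {a'} q-prime N≡qK 0<δ δ<q shift = gcd≡K
  where
  open ≡-Reasoning
  instance
    K≢0 : NonZero K
    K≢0 = m*n≢0⇒n≢0 q {{subst NonZero N≡qK it}}
  K∣N : K ∣ N
  K∣N = subst (K ∣_) (sym N≡qK) (n∣m*n q)
  K∣a-a' : K ∣ ∣ a - a' ∣
  K∣a-a' = %≡⇒∣∣-∣ (begin
    a % K               ≡⟨ [m+kn]%n≡m%n a δ K ⟨
    (a + δ * K) % K     ≡⟨ m∣n⇒o%n%m≡o%m K N (a + δ * K) K∣N ⟨
    (a + δ * K) % N % K ≡⟨ cong (_% K) shift ⟩
    a' % N % K          ≡⟨ m∣n⇒o%n%m≡o%m K N a' K∣N ⟩
    a' % K              ∎)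
  N∤a-a' : N ∤ ∣ a - a' ∣
  N∤a-a' N∣a-a' = <⇒≱ δ<q (∣⇒≤ {{>-nonZero 0<δ}} q∣δ)
    where
    δK≡0 : (δ * K) % N ≡ 0 % N
    δK≡0 = %≡-cancelˡ-+ a (trans shift (trans (sym (∣∣-∣⇒%≡ N∣a-a')) (cong (_% N) (sym (+-identityʳ a)))))
    q∣δ : q ∣ δ
    q∣δ = *-cancelʳ-∣ K (subst (_∣ δ * K) N≡qK (subst (N ∣_) (∣-∣-identityʳ (δ * K)) (%≡⇒∣∣-∣ δK≡0)))
  gcd≡K : gcd ∣ a - a' ∣ N ≡ K
  gcd≡K with gcd-greatest {∣ a - a' ∣} {N} K∣a-a' K∣N
  ... | divides t gcd≡tK with prime⇒irreducible q-prime (*-cancelʳ-∣ {t} {q} K (subst₂ _∣_ gcd≡tK N≡qK (gcd[m,n]∣n ∣ a - a' ∣ N)))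
  ...   | inj₁ t≡1 = trans gcd≡tK (trans (cong (_* K) t≡1) (*-identityˡ K))
  ...   | inj₂ t≡q = contradiction (subst (_∣ ∣ a - a' ∣) gcd≡N (gcd[m,n]∣m ∣ a - a' ∣ N)) N∤a-a'
    where
    gcd≡N : gcd ∣ a - a' ∣ N ≡ N
    gcd≡N = trans gcd≡tK (trans (cong (_* K) t≡q) (sym N≡qK))

without : ℕ → List ℕ → List ℕ
without j = filter (λ i → ¬? (i ≟ j))

module _ {_∙_ : ℕ → ℕ → ℕ} (ε : ℕ) (∙-assoc : Associative _∙_) (∙-comm : Commutative _∙_) (f : ℕ → ℕ) where
  open ≡-Reasoning

  foldr-map-without : ∀ {j xs} → Unique xs → j ∈ xs →
    foldr _∙_ ε (map f xs) ≡ f j ∙ foldr _∙_ ε (map f (without j xs))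
  foldr-map-without {j} {j ∷ xs} (j∉xs ∷ _) (here refl) = cong (λ ys → f j ∙ foldr _∙_ ε (map f ys)) (begin
    xs                ≡⟨ filter-all (λ i → ¬? (i ≟ j)) (All.map (_∘ sym) j∉xs) ⟨
    without j xs      ≡⟨ filter-reject (λ i → ¬? (i ≟ j)) {xs = xs} (λ j≢j → j≢j refl) ⟨
    without j (j ∷ xs) ∎)
  foldr-map-without {j} {x ∷ xs} (x∉xs ∷ xs!) (there j∈xs) = begin
    f x ∙ foldr _∙_ ε (map f xs)                   ≡⟨ cong (f x ∙_) (foldr-map-without xs! j∈xs) ⟩
    f x ∙ (f j ∙ rest)                             ≡⟨ ∙-assoc (f x) (f j) rest ⟨
    (f x ∙ f j) ∙ rest                             ≡⟨ cong (_∙ rest) (∙-comm (f x) (f j)) ⟩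
    (f j ∙ f x) ∙ rest                             ≡⟨ ∙-assoc (f j) (f x) rest ⟩
    f j ∙ foldr _∙_ ε (map f (x ∷ without j xs))   ≡⟨ cong (λ ys → f j ∙ foldr _∙_ ε (map f ys)) x∷without≡ ⟨
    f j ∙ foldr _∙_ ε (map f (without j (x ∷ xs))) ∎
    where
    rest = foldr _∙_ ε (map f (without j xs))
    x∷without≡ : without j (x ∷ xs) ≡ x ∷ without j xs
    x∷without≡ = filter-accept (λ i → ¬? (i ≟ j)) (All.lookup x∉xs j∈xs)

sum-map-without : ∀ (f : ℕ → ℕ) {j xs} → Unique xs → j ∈ xs → sum (map f xs) ≡ f j + sum (map f (without j xs))
sum-map-without = foldr-map-without 0 +-assoc +-comm

product-map-without : ∀ (f : ℕ → ℕ) {j xs} → Unique xs → j ∈ xs → product (map f xs) ≡ f j * product (map f (without j xs))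
product-map-without = foldr-map-without 1 *-assoc *-comm

range-unique : ∀ lo hi → Unique (range lo hi)
range-unique lo hi = Unique.applyUpTo⁺₁ _ _ λ i<j _ → <⇒≢ (+-monoʳ-< lo i<j)

∈-range⁺ : ∀ {lo hi i} → lo ≤ i → i ≤ hi → i ∈ range lo hi
∈-range⁺ {lo} {hi} lo≤i i≤hi =
  subst (_∈ range lo hi) (m+[n∸m]≡n lo≤i) (∈-applyUpTo⁺ (lo +_) (∸-monoˡ-< (s≤s i≤hi) lo≤i))

∈-range⁻ : ∀ {lo hi i} → i ∈ range lo hi → lo ≤ i × i ≤ hi
∈-range⁻ {lo} {hi} i∈ with k , k<len , refl ← ∈-applyUpTo⁻ (lo +_) i∈ =
  m≤m+n lo k , ≤-pred (subst (lo + k <_) (m+[n∸m]≡n {lo} {suc hi} lo≤1+hi) (+-monoʳ-< lo k<len))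
  where
  lo≤1+hi : lo ≤ suc hi
  lo≤1+hi = <⇒≤ (m∸n≢0⇒n<m λ len≡0 → n≮0 (subst (k <_) len≡0 k<len))

map≡map⇒≡ : ∀ {f g : ℕ → ℕ} {x} xs → map f xs ≡ map g xs → x ∈ xs → f x ≡ g x
map≡map⇒≡ (_ ∷ _)  eq (here refl) = proj₁ (∷-injective eq)
map≡map⇒≡ (_ ∷ xs) eq (there x∈)  = map≡map⇒≡ xs (proj₂ (∷-injective eq)) x∈

tuples : (ℕ → ℕ) → List ℕ → List (List ℕ)
tuples b []       = [ [] ]
tuples b (i ∷ is) = concatMap (λ v → map (v ∷_) (tuples b is)) (upTo (b i))

length-tuples : ∀ b is → length (tuples b is) ≡ product (map b is)
length-tuples b []       = refl
length-tuples b (i ∷ is) = trans (length-concatMap (upTo (b i))) (cong₂ _*_ (length-upTo (b i)) (length-tuples b is))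
  where
  length-concatMap : ∀ vs → length (concatMap (λ v → map (v ∷_) (tuples b is)) vs) ≡ length vs * length (tuples b is)
  length-concatMap []       = refl
  length-concatMap (v ∷ vs) =
    trans (length-++ (map (v ∷_) (tuples b is))) (cong₂ _+_ (length-map (v ∷_) (tuples b is)) (length-concatMap vs))

map∈tuples : ∀ {b c : ℕ → ℕ} is → All (λ i → c i < b i) is → map c is ∈ tuples b is
map∈tuples []       []               = here refl
map∈tuples (i ∷ is) (cᵢ<bᵢ ∷ cs<bs) =
  ∈-concatMap⁺ _ (Any.map (λ where refl → ∈-map⁺ _ (map∈tuples is cs<bs)) (∈-upTo⁺ cᵢ<bᵢ))

pigeonhole-∈ : ∀ {A : Set} {n} (xs : List A) → length xs < n → (f : ℕ → A) → (∀ u → u < n → f u ∈ xs) →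
  ∃₂ λ u v → u < v × v < n × f u ≡ f v
pigeonhole-∈ {n = n} xs len<n f f∈xs =
  let u , v , u<v , same = pigeonhole len<n position
  in toℕ u , toℕ v , u<v , toℕ<n v ,
     trans (lookup-index (f∈xs′ u)) (trans (cong (lookup xs) same) (sym (lookup-index (f∈xs′ v))))
  where
  f∈xs′ : ∀ (u : Fin n) → f (toℕ u) ∈ xs
  f∈xs′ u = f∈xs (toℕ u) (toℕ<n u)
  position : Fin n → Fin (length xs)
  position u = Any.index (f∈xs′ u)

_[_]≔_ : (ℕ → ℕ) → ℕ → ℕ → ℕ → ℕ
(c [ j ]≔ v) i with i ≟ j
... | yes _ = v
... | no  _ = c i

[]≔-same : ∀ c j v → (c [ j ]≔ v) j ≡ v
[]≔-same c j v with j ≟ j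
... | yes _   = refl
... | no  j≢j = contradiction refl j≢j

[]≔-other : ∀ c {i j} v → i ≢ j → (c [ j ]≔ v) i ≡ c i
[]≔-other c {i} {j} v i≢j with i ≟ j
... | yes i≡j = contradiction i≡j i≢j
... | no  _   = refl

module Digits (d : ℕ) (p : ℕ → ℕ)
  (prime : ∀ j → 1 ≤ j → j ≤ d → Prime (p j))
  (distinct : ∀ i j → 1 ≤ i → i ≤ d → 1 ≤ j → j ≤ d → i ≢ j → p i ≢ p j) where
  open ≡-Reasoning

  M : ℕ
  M = Mod d p

  g : ℕ → ℕ
  g = Mj d p

  IsDigits : (ℕ → ℕ) → Set
  IsDigits c = ∀ j → 1 ≤ j → j ≤ d → c j < p j

  digitSum : (ℕ → ℕ) → ℕ
  digitSum c = ∑[ 1 ⋯ d ] (λ j → c j * g j)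

  all-indices : ∀ {P : ℕ → Set} → (∀ i → 1 ≤ i → i ≤ d → P i) → All P (range 1 d)
  all-indices f = All.tabulate λ i∈ → let 1≤i , i≤d = ∈-range⁻ i∈ in f _ 1≤i i≤d

  all-without : ∀ {P : ℕ → Set} j → (∀ i → 1 ≤ i → i ≤ d → i ≢ j → P i) → All P (without j (range 1 d))
  all-without j f = All.tabulate λ i∈ →
    let i∈range , i≢j = ∈-filter⁻ (λ i → ¬? (i ≟ j)) i∈ ; 1≤i , i≤d = ∈-range⁻ i∈range in f _ 1≤i i≤d i≢j

  p≢0 : ∀ {j} → 1 ≤ j → j ≤ d → NonZero (p j)
  p≢0 {j} 1≤j j≤d = prime⇒nonZero (prime j 1≤j j≤d)

  instance
    M≢0 : NonZero M
    M≢0 = product≢0 (AllP.map⁺ (all-indices λ i 1≤i i≤d → m^n≢0 (p i) 2 {{p≢0 1≤i i≤d}}))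

  M≡p²*Mj : ∀ {j} → 1 ≤ j → j ≤ d → M ≡ p j ^ 2 * g j
  M≡p²*Mj 1≤j j≤d = product-map-without (λ i → p i ^ 2) (range-unique 1 d) (∈-range⁺ 1≤j j≤d)

  p∣Mj : ∀ {i j} → 1 ≤ i → i ≤ d → i ≢ j → p i ∣ g j
  p∣Mj {i} {j} 1≤i i≤d i≢j = ∣-trans (m∣m*n (p i * 1))
    (∈⇒∣product (∈-map⁺ (λ i → p i ^ 2) (∈-filter⁺ (λ i → ¬? (i ≟ j)) (∈-range⁺ 1≤i i≤d) i≢j)))

  p∤Mj : ∀ {j} → 1 ≤ j → j ≤ d → p j ∤ g j
  p∤Mj {j} 1≤j j≤d = prime∤product (prime j 1≤j j≤d) (AllP.map⁺ (all-without j p∤p²))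
    where
    p∤p : ∀ i → 1 ≤ i → i ≤ d → i ≢ j → p j ∤ p i
    p∤p i 1≤i i≤d i≢j pⱼ∣pᵢ with prime⇒irreducible (prime i 1≤i i≤d) pⱼ∣pᵢ
    ... | inj₁ pⱼ≡1  = nonTrivial⇒≢1 {{prime⇒nonTrivial (prime j 1≤j j≤d)}} pⱼ≡1
    ... | inj₂ pⱼ≡pᵢ = distinct i j 1≤i i≤d 1≤j j≤d i≢j (sym pⱼ≡pᵢ)
    p∤p² : ∀ i → 1 ≤ i → i ≤ d → i ≢ j → p j ∤ p i ^ 2
    p∤p² i 1≤i i≤d i≢j pⱼ∣pᵢ² with euclidsLemma (p i) (p i * 1) (prime j 1≤j j≤d) pⱼ∣pᵢ²
    ... | inj₁ pⱼ∣pᵢ  = p∤p i 1≤i i≤d i≢j pⱼ∣pᵢ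
    ... | inj₂ pⱼ∣pᵢ1 = p∤p i 1≤i i≤d i≢j (subst (p j ∣_) (*-identityʳ (p i)) pⱼ∣pᵢ1)

  digitSum-without : ∀ c {j} → 1 ≤ j → j ≤ d →
    digitSum c ≡ c j * g j + sum (map (λ i → c i * g i) (without j (range 1 d)))
  digitSum-without c 1≤j j≤d = sum-map-without (λ i → c i * g i) (range-unique 1 d) (∈-range⁺ 1≤j j≤d)

  digitSum%p : ∀ c {j} → 1 ≤ j → j ≤ d → .{{_ : NonZero (p j)}} → digitSum c % p j ≡ (c j * g j) % p j
  digitSum%p c {j} 1≤j j≤d = trans (cong (_% p j) (digitSum-without c 1≤j j≤d)) (%-remove-+ʳ (c j * g j) p∣rest)
    where
    p∣rest : p j ∣ sum (map (λ i → c i * g i) (without j (range 1 d)))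
    p∣rest = ∣-sum (AllP.map⁺ (all-without j λ i _ _ i≢j → ∣n⇒∣m*n (c i) (p∣Mj 1≤j j≤d (i≢j ∘ sym))))

  digitSum-injective : ∀ {c c'} → IsDigits c → IsDigits c' → digitSum c % M ≡ digitSum c' % M →
    ∀ j → 1 ≤ j → j ≤ d → c j ≡ c' j
  digitSum-injective {c} {c'} c<p c'<p same j 1≤j j≤d = begin
    c j        ≡⟨ m<n⇒m%n≡m (c<p j 1≤j j≤d) ⟨
    c j % p j  ≡⟨ prime-*-cancelʳ-%≡ (prime j 1≤j j≤d) (p∤Mj 1≤j j≤d) cg≡c'g ⟩
    c' j % p j ≡⟨ m<n⇒m%n≡m (c'<p j 1≤j j≤d) ⟩
    c' j       ∎
    where
    instance
      pⱼ≢0 : NonZero (p j)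
      pⱼ≢0 = p≢0 1≤j j≤d
    p∣M : p j ∣ M
    p∣M = subst (p j ∣_) (sym (M≡p²*Mj 1≤j j≤d)) (∣m⇒∣m*n (g j) (m∣m*n (p j * 1)))
    cg≡c'g : (c j * g j) % p j ≡ (c' j * g j) % p j
    cg≡c'g = begin
      (c j * g j) % p j     ≡⟨ digitSum%p c 1≤j j≤d ⟨
      digitSum c % p j      ≡⟨ m∣n⇒o%n%m≡o%m (p j) M (digitSum c) p∣M ⟨
      digitSum c % M % p j  ≡⟨ cong (_% p j) same ⟩
      digitSum c' % M % p j ≡⟨ m∣n⇒o%n%m≡o%m (p j) M (digitSum c') p∣M ⟩
      digitSum c' % p j     ≡⟨ digitSum%p c' 1≤j j≤d ⟩
      (c' j * g j) % p j    ∎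

  IsDigits-[]≔ : ∀ {c j v} → IsDigits c → v < p j → IsDigits (c [ j ]≔ v)
  IsDigits-[]≔ {c} {j} {v} c<p v<p i 1≤i i≤d with i ≟ j
  ... | yes refl = v<p
  ... | no  _    = c<p i 1≤i i≤d

  digitSum-cong : ∀ {c c'} → (∀ i → 1 ≤ i → i ≤ d → c i ≡ c' i) → digitSum c ≡ digitSum c'
  digitSum-cong c≡c' = cong sum (map-cong-local (all-indices λ i 1≤i i≤d → cong (_* g i) (c≡c' i 1≤i i≤d)))

  digitSum-zero : digitSum (λ _ → 0) ≡ 0
  digitSum-zero = sum-zeros (range 1 d)
    where
    sum-zeros : ∀ is → sum (map (λ i → 0 * g i) is) ≡ 0
    sum-zeros []       = refl
    sum-zeros (_ ∷ is) = sum-zeros is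

  digitSum-[]≔ : ∀ c {j} v → 1 ≤ j → j ≤ d → digitSum (c [ j ]≔ v) + c j * g j ≡ digitSum c + v * g j
  digitSum-[]≔ c {j} v 1≤j j≤d = begin
    digitSum (c [ j ]≔ v) + c j * g j                      ≡⟨ cong (_+ c j * g j) (digitSum-without (c [ j ]≔ v) 1≤j j≤d) ⟩
    ((c [ j ]≔ v) j * g j + rest (c [ j ]≔ v)) + c j * g j ≡⟨ cong₂ (λ x y → (x * g j + y) + c j * g j) ([]≔-same c j v) rest-unchanged ⟩
    (v * g j + rest c) + c j * g j                         ≡⟨ swap (v * g j) (rest c) (c j * g j) ⟩
    (c j * g j + rest c) + v * g j                         ≡⟨ cong (_+ v * g j) (digitSum-without c 1≤j j≤d) ⟨
    digitSum c + v * g j                                   ∎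
    where
    rest : (ℕ → ℕ) → ℕ
    rest c = sum (map (λ i → c i * g i) (without j (range 1 d)))
    rest-unchanged : rest (c [ j ]≔ v) ≡ rest c
    rest-unchanged = cong sum (map-cong-local (all-without j λ i _ _ i≢j → cong (_* g i) ([]≔-other c v i≢j)))
    swap : ∀ x y z → (x + y) + z ≡ (z + y) + x
    swap = solve-∀

module Tiling (d : ℕ) (p : ℕ → ℕ)
  (prime : ∀ j → 1 ≤ j → j ≤ d → Prime (p j))
  (distinct : ∀ i j → 1 ≤ i → i ≤ d → 1 ≤ j → j ≤ d → i ≢ j → p i ≢ p j)
  (A : ℕ → Set) (tiling : Tiles (Mod d p) A (InB d p)) where
  open ≡-Reasoning
  open Digits d p prime distinct public

  record Rep (x : ℕ) : Set where
    field
      a      : ℕ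
      c      : ℕ → ℕ
      a∈A    : A a
      c<p    : IsDigits c
      a+Σc≡x : (a + digitSum c) % M ≡ x % M

  private
    A<M : ∀ {a} → A a → a < M
    A<M = proj₁ tiling _

    decomposition = proj₂ (proj₂ tiling)

  represent : ∀ x → Rep x
  represent x with (a , b , a∈A , (_ , c , c<p , b≡Σc) , a+b≡x) , _ ← decomposition (x % M) (m%n<n x M) =
    record { a = a ; c = c ; a∈A = a∈A ; c<p = c<p ; a+Σc≡x = begin
      (a + digitSum c) % M ≡⟨ %≡-congˡ-+ a ([mod]⇒%≡ b≡Σc) ⟨
      (a + b) % M          ≡⟨ [mod]⇒%≡ a+b≡x ⟩
      x % M % M            ≡⟨ m%n%n≡m%n x M ⟩
      x % M                ∎ }

  Rep-unique : ∀ {x} (r r' : Rep x) → Rep.a r ≡ Rep.a r' × (∀ i → 1 ≤ i → i ≤ d → Rep.c r i ≡ Rep.c r' i)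
  Rep-unique {x} r r' =
    let a≡a' , b≡b' = proj₂ (decomposition (x % M) (m%n<n x M)) _ _ _ _
                        (Rep.a∈A r) (inB r) (Rep.a∈A r') (inB r') (a+b≡x r) (a+b≡x r')
    in a≡a' , digitSum-injective (Rep.c<p r) (Rep.c<p r') b≡b'
    where
    b : Rep x → ℕ
    b r = digitSum (Rep.c r) % M
    inB : (r : Rep x) → InB d p (b r)
    inB r = m%n<n _ M , Rep.c r , Rep.c<p r , %≡⇒[mod] (m%n%n≡m%n (digitSum (Rep.c r)) M)
    a+b≡x : (r : Rep x) → (Rep.a r + b r) ≡ (x % M) [mod M ]
    a+b≡x r = %≡⇒[mod] (begin
      (Rep.a r + b r) % M                ≡⟨ %≡-congˡ-+ (Rep.a r) (m%n%n≡m%n _ M) ⟩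
      (Rep.a r + digitSum (Rep.c r)) % M ≡⟨ Rep.a+Σc≡x r ⟩
      x % M                              ≡⟨ m%n%n≡m%n x M ⟨
      x % M % M                          ∎)

  Rep-cong : ∀ {x y} → x % M ≡ y % M → Rep x → Rep y
  Rep-cong x≡y r = record { a = Rep.a r ; c = Rep.c r ; a∈A = Rep.a∈A r ; c<p = Rep.c<p r ; a+Σc≡x = trans (Rep.a+Σc≡x r) x≡y }

  Rep-of-A : ∀ {a} → A a → Rep a
  Rep-of-A {a} a∈A = record
    { a = a ; c = λ _ → 0 ; a∈A = a∈A ; c<p = λ j 1≤j j≤d → >-nonZero⁻¹ (p j) {{p≢0 1≤j j≤d}}
    ; a+Σc≡x = cong (_% M) (trans (cong (a +_) digitSum-zero) (+-identityʳ a)) }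

  Rep-[]≔ : ∀ {x y j v} (r : Rep x) → 1 ≤ j → j ≤ d → v < p j → y + Rep.c r j * g j ≡ x + v * g j → Rep y
  Rep-[]≔ {x} {y} {j} {v} r 1≤j j≤d v<p y+cg≡x+vg = record
    { a = a ; c = c [ j ]≔ v ; a∈A = Rep.a∈A r ; c<p = IsDigits-[]≔ (Rep.c<p r) v<p
    ; a+Σc≡x = %≡-cancelˡ-+ (c j * g j) (begin
        (c j * g j + (a + digitSum (c [ j ]≔ v))) % M ≡⟨ cong (_% M) (regroup (c j * g j) a _) ⟩
        (a + (digitSum (c [ j ]≔ v) + c j * g j)) % M ≡⟨ cong (λ s → (a + s) % M) (digitSum-[]≔ c v 1≤j j≤d) ⟩
        (a + (digitSum c + v * g j)) % M              ≡⟨ cong (_% M) (+-assoc a (digitSum c) (v * g j)) ⟨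
        ((a + digitSum c) + v * g j) % M              ≡⟨ %≡-congʳ-+ {M} (v * g j) (Rep.a+Σc≡x r) ⟩
        (x + v * g j) % M                             ≡⟨ cong (_% M) (trans (sym y+cg≡x+vg) (+-comm y (c j * g j))) ⟩
        (c j * g j + y) % M                           ∎) }
    where
    a = Rep.a r
    c = Rep.c r
    regroup : ∀ x y z → x + (y + z) ≡ y + (z + x)
    regroup = solve-∀

  A-part : ℕ → ℕ
  A-part x = Rep.a (represent x)

  digit : ℕ → ℕ → ℕ
  digit x = Rep.c (represent x)

  digit<p : ∀ x {i} → 1 ≤ i → i ≤ d → digit x i < p i
  digit<p x = Rep.c<p (represent x) _

  digit-unique : ∀ {x} (r : Rep x) {i} → 1 ≤ i → i ≤ d → digit x i ≡ Rep.c r i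
  digit-unique r 1≤i i≤d = proj₂ (Rep-unique (represent _) r) _ 1≤i i≤d

  digit-cong : ∀ {x y} → x % M ≡ y % M → ∀ {i} → 1 ≤ i → i ≤ d → digit x i ≡ digit y i
  digit-cong x≡y = digit-unique (Rep-cong (sym x≡y) (represent _))

  A-part-of-A : ∀ {a} → A a → A-part a ≡ a
  A-part-of-A a∈A = proj₁ (Rep-unique (represent _) (Rep-of-A a∈A))

  InDiv? : ∀ n → Dec (InDiv M A n)
  InDiv? n = map′ from to (anyUpTo? (λ x → anyUpTo? (λ x' → gcd ∣ A-part x - A-part x' ∣ M ≟ n) M) M)
    where
    from : (∃ λ x → x < M × ∃ λ x' → x' < M × gcd ∣ A-part x - A-part x' ∣ M ≡ n) → InDiv M A n
    from (x , _ , x' , _ , gcd≡n) = A-part x , A-part x' , Rep.a∈A (represent x) , Rep.a∈A (represent x') , gcd≡n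
    to : InDiv M A n → ∃ λ x → x < M × ∃ λ x' → x' < M × gcd ∣ A-part x - A-part x' ∣ M ≡ n
    to (a , a' , a∈A , a'∈A , gcd≡n) = a , A<M a∈A , a' , A<M a'∈A ,
      subst₂ (λ b b' → gcd ∣ b - b' ∣ M ≡ n) (sym (A-part-of-A a∈A)) (sym (A-part-of-A a'∈A)) gcd≡n

  p*Mj∈Div? : Dec (∃ λ j → 1 ≤ j × j ≤ d × InDiv M A (p j * g j))
  p*Mj∈Div? = map′ (λ (j , j<1+d , 1≤j , div) → j , 1≤j , ≤-pred j<1+d , div)
                   (λ (j , 1≤j , j≤d , div) → j , s≤s j≤d , 1≤j , div)
                   (anyUpTo? (λ j → (1 ≤? j) ×-dec InDiv? (p j * g j)) (suc d))

  module Level {m} (1≤m : 1 ≤ m) (m≤d : m ≤ d) where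

    q : ℕ
    q = p m

    G : ℕ
    G = g m

    K : ℕ
    K = q * G

    instance
      q≢0 : NonZero q
      q≢0 = p≢0 1≤m m≤d

    M≡qK : M ≡ q * K
    M≡qK = trans (M≡p²*Mj 1≤m m≤d) (trans (cong (λ t → q * t * G) (*-identityʳ q)) (*-assoc q q G))

    q∸1<q : q ∸ 1 < q
    q∸1<q = subst (q ∸ 1 <_) (suc-pred q) (n<1+n (q ∸ 1))

    Vanishes : ℕ → Set
    Vanishes x = digit x m ≡ 0

    vanishes-+K : ∀ {y} → Vanishes y → Vanishes (y + K)
    vanishes-+K {y} y₀ with digit (y + K) m in cₘ≡
    ... | zero  = refl
    ... | suc k = contradiction 1+k<q (<-irrefl (trans (cong suc (sym q∸1≡k)) (suc-pred q)))
      where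
      z = y + (q ∸ 1) * G
      1+k<q : suc k < q
      1+k<q = subst (_< q) cₘ≡ (digit<p (y + K) 1≤m m≤d)
      regroup : ∀ y G q' k → (y + q' * G) + suc k * G ≡ (y + suc q' * G) + k * G
      regroup = solve-∀
      from-y : Rep z
      from-y = Rep-[]≔ (represent y) 1≤m m≤d q∸1<q (trans (cong (λ t → z + t * G) y₀) (+-identityʳ z))
      from-y+K : Rep z
      from-y+K = Rep-[]≔ (represent (y + K)) 1≤m m≤d (<-trans (n<1+n k) 1+k<q) (begin
        z + digit (y + K) m * G       ≡⟨ cong (λ t → z + t * G) cₘ≡ ⟩
        z + suc k * G                 ≡⟨ regroup y G (q ∸ 1) k ⟩
        (y + suc (q ∸ 1) * G) + k * G ≡⟨ cong (λ t → (y + t * G) + k * G) (suc-pred q) ⟩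
        (y + K) + k * G               ∎)
      q∸1≡k : q ∸ 1 ≡ k
      q∸1≡k = begin
        q ∸ 1           ≡⟨ []≔-same _ m (q ∸ 1) ⟨
        Rep.c from-y m   ≡⟨ proj₂ (Rep-unique from-y from-y+K) m 1≤m m≤d ⟩
        Rep.c from-y+K m ≡⟨ []≔-same _ m k ⟩
        k               ∎

    vanishes-+uK : ∀ u {y} → Vanishes y → Vanishes (y + u * K)
    vanishes-+uK zero    {y} y₀ = subst Vanishes (sym (+-identityʳ y)) y₀
    vanishes-+uK (suc u) {y} y₀ = subst Vanishes (+-assoc y K (u * K)) (vanishes-+uK u (vanishes-+K y₀))

    vanishes-+uK⁻¹ : ∀ u {y} → Vanishes (y + u * K) → Vanishes y
    vanishes-+uK⁻¹ u {y} yu₀ = trans (digit-cong (sym y+uqK≡y) 1≤m m≤d) (vanishes-+uK (u * (q ∸ 1)) yu₀)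
      where
      regroup : ∀ y u K q' → (y + u * K) + u * q' * K ≡ y + u * (suc q' * K)
      regroup = solve-∀
      y+uqK≡y : (y + u * K + u * (q ∸ 1) * K) % M ≡ y % M
      y+uqK≡y = begin
        (y + u * K + u * (q ∸ 1) * K) % M ≡⟨ cong (_% M) (regroup y u K (q ∸ 1)) ⟩
        (y + u * (suc (q ∸ 1) * K)) % M   ≡⟨ cong (λ t → (y + u * (t * K)) % M) (suc-pred q) ⟩
        (y + u * (q * K)) % M             ≡⟨ cong (λ t → (y + u * t) % M) M≡qK ⟨
        (y + u * M) % M                   ≡⟨ [m+kn]%n≡m%n y u M ⟩
        y % M                             ∎

    -- Raising digit j of y + uK would give a point whose m-th digit vanishes and
    -- which differs from y + g j by a multiple of K.
    digit-forced : ∀ {j y} → 1 ≤ j → j ≤ d → j ≢ m → Vanishes y → ¬ Vanishes (y + g j) →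
      ∀ u → digit (y + u * K) j ≡ p j ∸ 1
    digit-forced {j} {y} 1≤j j≤d j≢m y₀ y+g≢0 u with digit (y + u * K) j ≟ p j ∸ 1
    ... | yes cⱼ≡ = cⱼ≡
    ... | no  cⱼ≢ = contradiction (vanishes-+uK⁻¹ u (subst Vanishes yu+g≡ yu+g₀)) y+g≢0
      where
      yu = y + u * K
      cⱼ = digit yu j
      1+cⱼ<p : suc cⱼ < p j
      1+cⱼ<p = ≤∧≢⇒< (digit<p yu 1≤j j≤d) (λ 1+cⱼ≡p → cⱼ≢ (cong (_∸ 1) 1+cⱼ≡p))
      raised : Rep (yu + g j)
      raised = Rep-[]≔ (represent yu) 1≤j j≤d 1+cⱼ<p (+-assoc yu (g j) (cⱼ * g j))
      yu+g₀ : Vanishes (yu + g j)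
      yu+g₀ = trans (digit-unique raised 1≤m m≤d) (trans ([]≔-other _ _ (j≢m ∘ sym)) (vanishes-+uK u y₀))
      regroup : ∀ y uK g → y + uK + g ≡ y + g + uK
      regroup = solve-∀
      yu+g≡ : yu + g j ≡ y + g j + u * K
      yu+g≡ = regroup y (u * K) (g j)

    K∈Div : ∀ {y u v} → u < v → v < q → (∀ i → 1 ≤ i → i ≤ d → digit (y + u * K) i ≡ digit (y + v * K) i) →
      InDiv M A K
    K∈Div {y} {u} {v} u<v v<q same =
      A-part yu , A-part yv , Rep.a∈A (represent yu) , Rep.a∈A (represent yv) ,
      gcd-of-shift (prime m 1≤m m≤d) M≡qK (m<n⇒0<n∸m u<v) (≤-<-trans (m∸n≤m v u) v<q) shift
      where
      yu = y + u * K
      yv = y + v * K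
      δ = v ∸ u
      Σ = digitSum (digit yu)
      yu+δK≡yv : yu + δ * K ≡ yv
      yu+δK≡yv = begin
        y + u * K + δ * K   ≡⟨ +-assoc y (u * K) (δ * K) ⟩
        y + (u * K + δ * K) ≡⟨ cong (y +_) (*-distribʳ-+ K u δ) ⟨
        y + (u + δ) * K     ≡⟨ cong (λ t → y + t * K) (m+[n∸m]≡n (<⇒≤ u<v)) ⟩
        y + v * K           ∎
      regroup : ∀ x y z → x + (y + z) ≡ y + x + z
      regroup = solve-∀
      shift : (A-part yu + δ * K) % M ≡ A-part yv % M
      shift = %≡-cancelˡ-+ Σ (begin
        (Σ + (A-part yu + δ * K)) % M         ≡⟨ cong (_% M) (regroup Σ (A-part yu) (δ * K)) ⟩
        (A-part yu + Σ + δ * K) % M           ≡⟨ %≡-congʳ-+ {M} (δ * K) (Rep.a+Σc≡x (represent yu)) ⟩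
        (yu + δ * K) % M                      ≡⟨ cong (_% M) yu+δK≡yv ⟩
        yv % M                                ≡⟨ Rep.a+Σc≡x (represent yv) ⟨
        (A-part yv + digitSum (digit yv)) % M ≡⟨ cong (λ s → (A-part yv + s) % M) (digitSum-cong same) ⟨
        (A-part yv + Σ) % M                   ≡⟨ cong (_% M) (+-comm (A-part yv) Σ) ⟩
        (Σ + A-part yv) % M                   ∎)

    K∈Div-by-pigeonhole : ∀ y (free : List ℕ) → All (λ i → 1 ≤ i × i ≤ d) free → product (map p free) < q →
      (∀ u i → 1 ≤ i → i ≤ d → i ∉ free → digit (y + u * K) i ≡ digit y i) → InDiv M A K
    K∈Div-by-pigeonhole y free free⊆ bound frozen =
      let u , v , u<v , v<q , same-tuple = pigeonhole-∈ (tuples p free) (subst (_< q) (sym (length-tuples p free)) bound) tuple tuple∈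
      in K∈Div u<v v<q (same u v same-tuple)
      where
      tuple : ℕ → List ℕ
      tuple u = map (digit (y + u * K)) free
      tuple∈ : ∀ u → u < q → tuple u ∈ tuples p free
      tuple∈ u _ = map∈tuples free (All.map (λ (1≤i , i≤d) → digit<p (y + u * K) 1≤i i≤d) free⊆)
      same : ∀ u v → tuple u ≡ tuple v → ∀ i → 1 ≤ i → i ≤ d → digit (y + u * K) i ≡ digit (y + v * K) i
      same u v eq i 1≤i i≤d with i ∈? free
      ... | yes i∈ = map≡map⇒≡ free eq i∈
      ... | no  i∉ = trans (frozen u i 1≤i i≤d i∉) (sym (frozen v i 1≤i i≤d i∉))

module _ {d : ℕ} {p : ℕ → ℕ} (increasing : ∀ i j → 1 ≤ i → i < j → j ≤ d → p i < p j) where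

  increasing⇒distinct : ∀ i j → 1 ≤ i → i ≤ d → 1 ≤ j → j ≤ d → i ≢ j → p i ≢ p j
  increasing⇒distinct i j 1≤i i≤d 1≤j j≤d i≢j with <-cmp i j
  ... | tri< i<j _ _ = <⇒≢ (increasing i j 1≤i i<j j≤d)
  ... | tri≈ _ i≡j _ = contradiction i≡j i≢j
  ... | tri> _ _ j<i = >⇒≢ (increasing j i 1≤j j<i i≤d)

  product-without< : (∀ j → 1 ≤ j → j ≤ d → Prime (p j)) → (∀ j → 3 ≤ j → j ≤ d → ∏[ 2 ⋯ j ∸ 1 ] p < p j) →
    ∀ {j k} → 1 ≤ j → j ≤ k → suc k ≤ d → product (map p (without j (range 1 k))) < p (suc k)
  product-without< prime growth {k = zero} 1≤j j≤0 = contradiction (≤-trans 1≤j j≤0) λ ()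
  product-without< prime growth {j} {suc k} 1≤j j≤1+k 2+k≤d = *-cancelˡ-< (p j) _ _ (begin-strict
    p j * product (map p (without j (range 1 (suc k)))) ≡⟨ product-map-without p (range-unique 1 (suc k)) (∈-range⁺ 1≤j j≤1+k) ⟨
    p 1 * ∏[ 2 ⋯ suc k ] p                              ≤⟨ *-monoˡ-≤ (∏[ 2 ⋯ suc k ] p) p₁≤pⱼ ⟩
    p j * ∏[ 2 ⋯ suc k ] p                              <⟨ *-monoʳ-< (p j) (growth′ k 2+k≤d) ⟩
    p j * p (suc (suc k))                               ∎)
    where
    open ≤-Reasoning
    j≤d : j ≤ d
    j≤d = ≤-trans j≤1+k (≤-trans (n≤1+n (suc k)) 2+k≤d)
    instance
      pⱼ≢0 : NonZero (p j)
      pⱼ≢0 = prime⇒nonZero (prime j 1≤j j≤d)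
    p₁≤pⱼ : p 1 ≤ p j
    p₁≤pⱼ with m≤n⇒m<n∨m≡n 1≤j
    ... | inj₁ 1<j  = <⇒≤ (increasing 1 j ≤-refl 1<j j≤d)
    ... | inj₂ refl = ≤-refl
    growth′ : ∀ k → suc (suc k) ≤ d → ∏[ 2 ⋯ suc k ] p < p (suc (suc k))
    growth′ zero    2≤d   = nonTrivial⇒n>1 (p 2) {{prime⇒nonTrivial (prime 2 (s≤s z≤n) 2≤d)}}
    growth′ (suc k) 3+k≤d = growth (suc (suc (suc k))) (s≤s (s≤s (s≤s z≤n))) 3+k≤d

module Descent {d : ℕ} {p : ℕ → ℕ}
  (prime : ∀ j → 1 ≤ j → j ≤ d → Prime (p j))
  (increasing : ∀ i j → 1 ≤ i → i < j → j ≤ d → p i < p j)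
  (A : ℕ → Set) (tiling : Tiles (Mod d p) A (InB d p))
  (growth : ∀ j → 3 ≤ j → j ≤ d → ∏[ 2 ⋯ j ∸ 1 ] p < p j)
  (noDiv : ∀ j → 1 ≤ j → j ≤ d → ¬ InDiv (Mod d p) A (p j * Mj d p j)) where

  open Tiling d p prime (increasing⇒distinct increasing) A tiling

  a₀ : ℕ
  a₀ = A-part 0

  digit-a₀ : ∀ {i} → 1 ≤ i → i ≤ d → digit a₀ i ≡ 0
  digit-a₀ = digit-unique (Rep-of-A (Rep.a∈A (represent 0)))

  data Reach (k : ℕ) : ℕ → Set where
    origin : Reach k a₀
    step   : ∀ {x j} → 1 ≤ j → j ≤ k → Reach k x → Reach k (x + g j)

  Reach-weaken : ∀ {k k' x} → k ≤ k' → Reach k x → Reach k' x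
  Reach-weaken k≤k' origin           = origin
  Reach-weaken k≤k' (step 1≤j j≤k r) = step 1≤j (≤-trans j≤k k≤k') (Reach-weaken k≤k' r)

  Reach-+nG : ∀ {k x j} → 1 ≤ j → j ≤ k → Reach k x → ∀ n → Reach k (x + n * g j)
  Reach-+nG {x = x}     1≤j j≤k r zero    = subst (Reach _) (sym (+-identityʳ x)) r
  Reach-+nG {x = x} {j} 1≤j j≤k r (suc n) = subst (Reach _) x+nG+G≡ (step 1≤j j≤k (Reach-+nG 1≤j j≤k r n))
    where
    x+nG+G≡ : x + n * g j + g j ≡ x + suc n * g j
    x+nG+G≡ = trans (+-assoc x (n * g j) (g j)) (cong (x +_) (+-comm (n * g j) (g j)))

  Claim : ℕ → Set
  Claim k = ∀ {x} → Reach k x → ∀ i → k < i → i ≤ d → digit x i ≡ 0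

  claim-top : Claim d
  claim-top _ i d<i i≤d = contradiction i≤d (<⇒≱ d<i)

  module _ {m} (1≤m : 1 ≤ m) (m≤d : m ≤ d) where
    open Level 1≤m m≤d

    Reach-+uK : ∀ {x} → Reach m x → ∀ u → Reach m (x + u * K)
    Reach-+uK {x} r u = subst (λ n → Reach m (x + n)) (*-assoc u q G) (Reach-+nG 1≤m ≤-refl r (u * q))

    digits-frozen-above : Claim m → ∀ {y} → Reach m y → Vanishes y →
      ∀ u i → m ≤ i → i ≤ d → digit (y + u * K) i ≡ digit y i
    digits-frozen-above claim r y₀ u i m≤i i≤d with m≤n⇒m<n∨m≡n m≤i
    ... | inj₁ m<i  = trans (claim (Reach-+uK r u) i m<i i≤d) (sym (claim r i m<i i≤d))
    ... | inj₂ refl = trans (vanishes-+uK u y₀) (sym y₀)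

  module _ {k} (1+k≤d : suc k ≤ d) (claim : Claim (suc k)) where
    open Level (s≤s z≤n) 1+k≤d

    K∈Div-at-boundary : ∀ {y j} → Reach k y → Vanishes y → 1 ≤ j → j ≤ k → ¬ Vanishes (y + g j) → InDiv M A K
    K∈Div-at-boundary {y} {j} r y₀ 1≤j j≤k y+g≢0 =
      K∈Div-by-pigeonhole y (without j (range 1 k)) free⊆ (product-without< increasing prime growth 1≤j j≤k 1+k≤d) frozen
      where
      k≤d = ≤-trans (n≤1+n k) 1+k≤d
      free⊆ : All (λ i → 1 ≤ i × i ≤ d) (without j (range 1 k))
      free⊆ = All.tabulate λ i∈ →
        let 1≤i , i≤k = ∈-range⁻ (proj₁ (∈-filter⁻ (λ i → ¬? (i ≟ j)) i∈)) in 1≤i , ≤-trans i≤k k≤d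
      forced : ∀ u → digit (y + u * K) j ≡ p j ∸ 1
      forced = digit-forced 1≤j (≤-trans j≤k k≤d) (<⇒≢ (s≤s j≤k)) y₀ y+g≢0
      frozen : ∀ u i → 1 ≤ i → i ≤ d → i ∉ without j (range 1 k) → digit (y + u * K) i ≡ digit y i
      frozen u i 1≤i i≤d i∉free with suc k ≤? i | i ≟ j
      ... | yes 1+k≤i | _        = digits-frozen-above (s≤s z≤n) 1+k≤d claim (Reach-weaken (n≤1+n k) r) y₀ u i 1+k≤i i≤d
      ... | no  _     | yes refl = trans (forced u) (sym (subst (λ z → digit z j ≡ p j ∸ 1) (+-identityʳ y) (forced 0)))
      ... | no  1+k≰i | no  i≢j  = contradiction (∈-filter⁺ (λ i → ¬? (i ≟ j)) (∈-range⁺ 1≤i (≤-pred (≰⇒> 1+k≰i))) i≢j) i∉free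

    vanishes-on-Reach : ∀ {x} → Reach k x → Vanishes x
    vanishes-on-Reach origin           = digit-a₀ (s≤s z≤n) 1+k≤d
    vanishes-on-Reach (step 1≤j j≤k r) = decidable-stable (digit _ (suc k) ≟ 0) λ x+g≢0 →
      noDiv (suc k) (s≤s z≤n) 1+k≤d (K∈Div-at-boundary r (vanishes-on-Reach r) 1≤j j≤k x+g≢0)

    claim-step : Claim k
    claim-step r i k<i i≤d with m≤n⇒m<n∨m≡n k<i
    ... | inj₁ 1+k<i = claim (Reach-weaken (n≤1+n k) r) i 1+k<i i≤d
    ... | inj₂ refl  = vanishes-on-Reach r

  claims : ∀ n {k} → n + k ≡ d → Claim k
  claims zero        refl       = claim-top
  claims (suc n) {k} 1+n+k≡d = claim-step (subst (suc k ≤_) n+1+k≡d (m≤n+m (suc k) n)) (claims n n+1+k≡d)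
    where
    n+1+k≡d : n + suc k ≡ d
    n+1+k≡d = trans (+-suc n k) 1+n+k≡d

  claim-bottom : (1≤d : 1 ≤ d) → Claim 1 → InDiv M A (Level.K ≤-refl 1≤d)
  claim-bottom 1≤d claim = K∈Div-by-pigeonhole a₀ [] [] (nonTrivial⇒n>1 q {{prime⇒nonTrivial (prime 1 ≤-refl 1≤d)}})
    λ u i 1≤i i≤d _ → digits-frozen-above ≤-refl 1≤d claim origin (digit-a₀ ≤-refl 1≤d) u i 1≤i i≤d
    where open Level ≤-refl 1≤d

  absurd : 1 ≤ d → ⊥
  absurd 1≤d = noDiv 1 ≤-refl 1≤d (claim-bottom 1≤d (claims (d ∸ 1) (m∸n+n≡m 1≤d)))

lemma6p4 : (d : ℕ) → 1 ≤ d → (p : ℕ → ℕ) →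
    (∀ j → 1 ≤ j → j ≤ d → Prime (p j)) →
    (∀ i j → 1 ≤ i → i < j → j ≤ d → p i < p j) →
    (A : ℕ → Set) → Tiles (Mod d p) A (InB d p) →
    (∀ j → 3 ≤ j → j ≤ d → ∏[ 2 ⋯ j ∸ 1 ] p < p j) →
    ∃ λ j → 1 ≤ j × j ≤ d × InDiv (Mod d p) A (p j * Mj d p j)
lemma6p4 d 1≤d p prime increasing A tiling growth = decidable-stable p*Mj∈Div? λ ¬div →
  Descent.absurd prime increasing A tiling growth (λ j 1≤j j≤d div → ¬div (j , 1≤j , j≤d , div)) 1≤d
  where open Tiling d p prime (increasing⇒distinct increasing) A tiling
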